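{- Let $G$ be a graph with universal homotopy cover $\rho:U_vG\to G$, let $S\le D(G)$ be a subgroup, and let $r:U_vG/S\to G$, $r([u])=\rho(u)$. Then for every vertex $w$ of $G$, the fibre $r^{ -1}(w)$ has cardinality equal to the index $[D(G):S]$.
   Context: All graphs are undirected, have no multiple edges, may have loops, are connected, and are not a single isolated vertex. A walk is a sequence $(v_0\cdots v_n)$ with $v_i\sim v_{i+1}$. A prune of a walk with $v_i=v_{i+2}$ replaces $v_iv_{i+1}v_i$ by $v_i$; a spider move on $(v_0\cdots v_n)$ replaces one $v_i$, $0<i<n$, by $v_i'$ with $v_{i-1}\sim v_i'\sim v_{i+1}$; walks are equivalent if connected by finitely many prunes, inverse prunes and spider moves. $\Pi(G)$ is the groupoid of vertices and equivalence classes of walks under concatenation ($\alpha*\beta$ = $\alpha$ then $\beta$); $\Pi_v(G)$ is the set of arrows with source $v$. $U_vG$ is the graph whose vertices are the arrows of $\Pi_v(G)$, with $\alpha\sim\beta$ iff $\beta=\alpha*[(wx)]$ for an edge $w\sim x$ with $w$ the target of $\alpha$; $\rho$ sends an arrow to its target. $D(G)$ is the group of graph automorphisms $\varphi$ of $U_vG$ with $\rho\circ\varphi=\rho$ (isomorphic to the fundamental group $\Pi_v^v(G)$ of closed walks at $v$ via $\gamma\mapsto(\alpha\mapsto\gamma*\alpha)$). $U_vG/S$ is the graph of $S$-orbits of vertices of $U_vG$, two orbits adjacent iff they have adjacent representatives. -}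

module Defs where

open import Data.List using (List; []; _∷_; _++_; [_])
open import Data.List.Relation.Unary.Linked using (Linked)
open import Data.Product using (Σ; ∃; ∃-syntax; _×_; _,_; proj₁; proj₂)
open import Function using (_∘_; id)
open import Relation.Binary.PropositionalEquality using (_≡_; refl; trans)
open import Relation.Binary.Construct.Closure.Equivalence using (EqClosure)
open import Relation.Binary.Construct.Closure.ReflexiveTransitive using (ε; _◅◅_)

lastV : {V : Set} → V → List V → V
lastV x []       = x
lastV x (y ∷ ys) = lastV y ys

-- A graph: undirected (symmetric adjacency), no multiple edges (adjacency is
-- proof-irrelevant), loops allowed, connected, not a single isolated vertex.
record Graph : Set₁ where
  field
    V      : Set
    _~_    : V → V → Set
    ~-sym  : ∀ {x y} → x ~ y → y ~ x
    ~-prop : ∀ {x y} (p q : x ~ y) → p ≡ q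
    connected : ∀ x y → ∃[ xs ] (Linked _~_ (x ∷ xs) × lastV x xs ≡ y)
    notIsolatedVertex : ∃[ x ] ∃[ y ] (x ~ y)

module _ (G : Graph) where
  open Graph G

  data Step : List V → List V → Set where
    prune  : ∀ l {a b} r → a ~ b →
             Step (l ++ (a ∷ b ∷ a ∷ r)) (l ++ (a ∷ r))
    spider : ∀ l {x y y' z} r → x ~ y → y ~ z → x ~ y' → y' ~ z →
             Step (l ++ (x ∷ y ∷ z ∷ r)) (l ++ (x ∷ y' ∷ z ∷ r))

  _≃w_ : List V → List V → Set
  _≃w_ = EqClosure Step

  module _ (v : V) where
    -- vertices of U_v G: walks (v x₁ ⋯ xₙ) starting at v (taken up to ≃U)
    UVert : Set
    UVert = Σ (List V) (λ xs → Linked _~_ (v ∷ xs))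

    _≃U_ : UVert → UVert → Set
    α ≃U β = (v ∷ proj₁ α) ≃w (v ∷ proj₁ β)

    ρ : UVert → V
    ρ α = lastV v (proj₁ α)

    _~U_ : UVert → UVert → Set
    α ~U β = ∃[ x ] (ρ α ~ x × ((v ∷ proj₁ β) ≃w (v ∷ (proj₁ α ++ [ x ]))))

    -- elements of D(G): graph automorphisms φ of U_v G with ρ ∘ φ = ρ
    -- (maps on representatives respecting ≃U, with inverse g)
    record Deck : Set where
      field
        f g    : UVert → UVert
        f-cong : ∀ {α β} → α ≃U β → f α ≃U f β
        g-cong : ∀ {α β} → α ≃U β → g α ≃U g β
        fg     : ∀ α → f (g α) ≃U α
        gf     : ∀ α → g (f α) ≃U α
        f-adj  : ∀ {α β} → α ~U β → f α ~U f β
        f-adj⁻ : ∀ {α β} → f α ~U f β → α ~U β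
        g-adj  : ∀ {α β} → α ~U β → g α ~U g β
        g-adj⁻ : ∀ {α β} → g α ~U g β → α ~U β
        f-ρ    : ∀ α → ρ (f α) ≡ ρ α
        g-ρ    : ∀ α → ρ (g α) ≡ ρ α
    open Deck public

    _≈D_ : Deck → Deck → Set
    φ ≈D ψ = ∀ α → f φ α ≃U f ψ α

    idD : Deck
    idD = record
      { f = id ; g = id ; f-cong = id ; g-cong = id
      ; fg = λ _ → ε ; gf = λ _ → ε
      ; f-adj = id ; f-adj⁻ = id ; g-adj = id ; g-adj⁻ = id
      ; f-ρ = λ _ → refl ; g-ρ = λ _ → refl }

    _∘D_ : Deck → Deck → Deck
    φ ∘D ψ = record
      { f = f φ ∘ f ψ ; g = g ψ ∘ g φ
      ; f-cong = f-cong φ ∘ f-cong ψ ; g-cong = g-cong ψ ∘ g-cong φ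
      ; fg = λ α → f-cong φ (fg ψ (g φ α)) ◅◅ fg φ α
      ; gf = λ α → g-cong ψ (gf φ (f ψ α)) ◅◅ gf ψ α
      ; f-adj = f-adj φ ∘ f-adj ψ ; f-adj⁻ = f-adj⁻ ψ ∘ f-adj⁻ φ
      ; g-adj = g-adj ψ ∘ g-adj φ ; g-adj⁻ = g-adj⁻ φ ∘ g-adj⁻ ψ
      ; f-ρ = λ α → trans (f-ρ φ (f ψ α)) (f-ρ ψ α)
      ; g-ρ = λ α → trans (g-ρ ψ (g φ α)) (g-ρ φ α) }

    invD : Deck → Deck
    invD φ = record
      { f = g φ ; g = f φ ; f-cong = g-cong φ ; g-cong = f-cong φ
      ; fg = gf φ ; gf = fg φ
      ; f-adj = g-adj φ ; f-adj⁻ = g-adj⁻ φ ; g-adj = f-adj φ ; g-adj⁻ = f-adj⁻ φ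
      ; f-ρ = g-ρ φ ; g-ρ = f-ρ φ }

    record Subgroup : Set₁ where
      field
        P     : Deck → Set
        P-resp : ∀ {φ ψ} → φ ≈D ψ → P φ → P ψ
        P-id  : P idD
        P-∘   : ∀ {φ ψ} → P φ → P ψ → P (φ ∘D ψ)
        P-inv : ∀ {φ} → P φ → P (invD φ)
    open Subgroup public

    module _ (S : Subgroup) where
      _∼coset_ : Deck → Deck → Set
      φ ∼coset ψ = P S (invD φ ∘D ψ)

      -- the fibre r⁻¹(w) ⊆ U_v G / S: representatives with target w,
      -- identified when in the same S-orbit
      Fibre : V → Set
      Fibre w = Σ UVert (λ α → ρ α ≡ w)

      _∼orbit_ : ∀ {w} → Fibre w → Fibre w → Set
      α ∼orbit β = ∃[ φ ] (P S φ × f φ (proj₁ α) ≃U proj₁ β)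

-- A bijection between the quotients A/R and B/Q
-- (maps respecting the relations, mutually inverse up to the relations).
record QuotBij {A B : Set} (R : A → A → Set) (Q : B → B → Set) : Set where
  field
    to     : A → B
    from   : B → A
    to-resp   : ∀ {a a'} → R a a' → Q (to a) (to a')
    from-resp : ∀ {b b'} → Q b b' → R (from b) (from b')
    from-to   : ∀ a → R (from (to a)) a
    to-from   : ∀ b → Q (to (from b)) b

-- Fix a walk α₀ from v to w.  Deck transformations act on the fibre over w
-- freely, since a deck transformation is determined by the image of a single
-- vertex (U_v G is connected and adjacent lifts are unique), and transitively,
-- since left multiplication by the closed walk β * α⁻¹ sends α to β.  Hence
-- φ ↦ φ⁻¹(α₀) is a bijection from D(G) onto the fibre, and it identifies
-- left S-cosets with S-orbits.
module Submission where

open import Defs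
open import Data.List using (List; []; _∷_; _++_; [_])
open import Data.List.Properties using (++-assoc; ++-identityʳ)
open import Data.List.Relation.Unary.Linked using (Linked; [-]; _∷_)
open import Data.Product using (Σ; _,_; proj₁; proj₂)
open import Function using (_∘_)
open import Relation.Binary.Definitions using (Symmetric)
open import Relation.Binary.PropositionalEquality
  using (_≡_; refl; sym; trans; cong; cong₂; subst; subst₂; isEquivalence; module ≡-Reasoning)
import Relation.Binary.Construct.Closure.Equivalence as EqClosure
open import Relation.Binary.Construct.Closure.ReflexiveTransitive using (ε; _◅◅_)
import Relation.Binary.Construct.On as On
import Relation.Binary.Reasoning.Setoid as SetoidReasoning

module _ {V : Set} where

  lastV-++ : ∀ (x : V) xs ys → lastV x (xs ++ ys) ≡ lastV (lastV x xs) ys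
  lastV-++ x []       ys = refl
  lastV-++ x (y ∷ xs) ys = lastV-++ y xs ys

  -- The walk a ∷ xs traversed backwards is lastV a xs ∷ reverseTail a xs.
  reverseTail : V → List V → List V
  reverseTail a []       = []
  reverseTail a (x ∷ xs) = reverseTail x xs ++ [ a ]

  lastV-reverseTail : ∀ a xs → lastV (lastV a xs) (reverseTail a xs) ≡ a
  lastV-reverseTail a []       = refl
  lastV-reverseTail a (x ∷ xs) = lastV-++ (lastV x xs) (reverseTail x xs) [ a ]

  reverseTail-∷ʳ : ∀ (a : V) xs b → reverseTail a (xs ++ [ b ]) ≡ lastV a xs ∷ reverseTail a xs
  reverseTail-∷ʳ a []       b = refl
  reverseTail-∷ʳ a (x ∷ xs) b = cong (_++ [ a ]) (reverseTail-∷ʳ x xs b)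

  reverseTail-involutive : ∀ a xs → reverseTail (lastV a xs) (reverseTail a xs) ≡ xs
  reverseTail-involutive a []       = refl
  reverseTail-involutive a (x ∷ xs) = begin
    reverseTail (lastV x xs) (reverseTail x xs ++ [ a ])
      ≡⟨ reverseTail-∷ʳ (lastV x xs) (reverseTail x xs) a ⟩
    lastV (lastV x xs) (reverseTail x xs) ∷ reverseTail (lastV x xs) (reverseTail x xs)
      ≡⟨ cong₂ _∷_ (lastV-reverseTail x xs) (reverseTail-involutive x xs) ⟩
    x ∷ xs ∎
    where open ≡-Reasoning

  module _ {R : V → V → Set} where

    Linked-++ : ∀ {x xs ys} → Linked R (x ∷ xs) → Linked R (lastV x xs ∷ ys) →
                Linked R (x ∷ xs ++ ys)
    Linked-++ {xs = []}     _          l₂ = l₂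
    Linked-++ {xs = y ∷ xs} (r ∷ l₁) l₂ = r ∷ Linked-++ l₁ l₂

    Linked-junction : ∀ {x} xs {y ys} → Linked R (x ∷ xs ++ y ∷ ys) → R (lastV x xs) y
    Linked-junction []       (r ∷ _) = r
    Linked-junction (_ ∷ xs) (_ ∷ l) = Linked-junction xs l

    Linked-reverseTail : Symmetric R → ∀ {a} xs → Linked R (a ∷ xs) →
                         Linked R (lastV a xs ∷ reverseTail a xs)
    Linked-reverseTail R-sym []            _       = [-]
    Linked-reverseTail R-sym {a} (x ∷ xs) (r ∷ l) =
      Linked-++ (Linked-reverseTail R-sym xs l)
        (subst (λ z → Linked R (z ∷ [ a ])) (sym (lastV-reverseTail x xs)) (R-sym r ∷ [-]))

module _ (G : Graph) where
  open Graph G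

  infix 4 _≈_
  _≈_ : List V → List V → Set
  _≈_ = _≃w_ G

  module ≈-Reasoning = SetoidReasoning (EqClosure.setoid (Step G))

  ≈-sym : ∀ {xs ys} → xs ≈ ys → ys ≈ xs
  ≈-sym = EqClosure.symmetric (Step G)

  ≡⇒≈ : ∀ {xs ys} → xs ≡ ys → xs ≈ ys
  ≡⇒≈ refl = ε

  ∷-cong : ∀ x {xs ys} → xs ≈ ys → x ∷ xs ≈ x ∷ ys
  ∷-cong x = EqClosure.gmap (x ∷_) step
    where
    step : ∀ {xs ys} → Step G xs ys → Step G (x ∷ xs) (x ∷ ys)
    step (prune l r e)            = prune (x ∷ l) r e
    step (spider l r e₁ e₂ e₃ e₄) = spider (x ∷ l) r e₁ e₂ e₃ e₄

  ++-congʳ : ∀ zs {xs ys} → xs ≈ ys → xs ++ zs ≈ ys ++ zs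
  ++-congʳ zs = EqClosure.gmap (_++ zs) step
    where
    step : ∀ {xs ys} → Step G xs ys → Step G (xs ++ zs) (ys ++ zs)
    step (prune l {a} {b} r e) =
      subst₂ (Step G) (sym (++-assoc l (a ∷ b ∷ a ∷ r) zs)) (sym (++-assoc l (a ∷ r) zs))
        (prune l (r ++ zs) e)
    step (spider l {x} {y} {y'} {z} r e₁ e₂ e₃ e₄) =
      subst₂ (Step G)
        (sym (++-assoc l (x ∷ y ∷ z ∷ r) zs)) (sym (++-assoc l (x ∷ y' ∷ z ∷ r) zs))
        (spider l (r ++ zs) e₁ e₂ e₃ e₄)

  -- x ∷ xs ++ ys is the concatenation of the walks x ∷ xs and a ∷ ys.
  ∷-++-congʳ : ∀ {x} xs {a ys zs} → lastV x xs ≡ a → a ∷ ys ≈ a ∷ zs →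
               x ∷ xs ++ ys ≈ x ∷ xs ++ zs
  ∷-++-congʳ []       refl h = h
  ∷-++-congʳ (y ∷ xs) eq   h = ∷-cong _ (∷-++-congʳ xs eq h)

  lastV-resp-≈ : ∀ x {xs ys} → xs ≈ ys → lastV x xs ≡ lastV x ys
  lastV-resp-≈ x = EqClosure.gfold isEquivalence (lastV x) step
    where
    step : ∀ {xs ys} → Step G xs ys → lastV x xs ≡ lastV x ys
    step (prune l _ _)        = trans (lastV-++ x l _) (sym (lastV-++ x l _))
    step (spider l _ _ _ _ _) = trans (lastV-++ x l _) (sym (lastV-++ x l _))

  cancel-reverseTail : ∀ {a} xs r → Linked _~_ (a ∷ xs) →
                       a ∷ xs ++ reverseTail a xs ++ r ≈ a ∷ r
  cancel-reverseTail []           r _            = ε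
  cancel-reverseTail {a} (x ∷ xs) r (a~x ∷ lk) = begin
    a ∷ x ∷ xs ++ (reverseTail x xs ++ [ a ]) ++ r
      ≡⟨ cong (λ t → a ∷ x ∷ xs ++ t) (++-assoc (reverseTail x xs) [ a ] r) ⟩
    a ∷ x ∷ xs ++ reverseTail x xs ++ a ∷ r
      ≈⟨ ∷-cong a (cancel-reverseTail xs (a ∷ r) lk) ⟩
    a ∷ x ∷ a ∷ r
      ≈⟨ EqClosure.return (prune [] r a~x) ⟩
    a ∷ r ∎
    where open ≈-Reasoning

  cancel-reverseTail′ : ∀ {a} xs r → Linked _~_ (a ∷ xs) →
                        lastV a xs ∷ reverseTail a xs ++ xs ++ r ≈ lastV a xs ∷ r
  cancel-reverseTail′ {a} xs r lk =
    subst (λ ys → lastV a xs ∷ reverseTail a xs ++ ys ++ r ≈ lastV a xs ∷ r)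
      (reverseTail-involutive a xs)
      (cancel-reverseTail (reverseTail a xs) r (Linked-reverseTail ~-sym xs lk))

  module _ (v : V) where

    infix 4 _≃_ _∼_
    _≃_ : UVert G v → UVert G v → Set
    _≃_ = _≃U_ G v

    _∼_ : UVert G v → UVert G v → Set
    _∼_ = _~U_ G v

    infixl 7 _·_
    infix 8 _⁻¹
    _·_ : Deck G v → Deck G v → Deck G v
    _·_ = _∘D_ G v

    _⁻¹ : Deck G v → Deck G v
    _⁻¹ = invD G v

    module ≃-Reasoning = SetoidReasoning
      (On.setoid (EqClosure.setoid (Step G)) (λ (α : UVert G v) → v ∷ proj₁ α))

    ∼-resp-≃ : ∀ {α α' β β'} → α ≃ α' → β ≃ β' → α ∼ β → α' ∼ β'
    ∼-resp-≃ α≃α' β≃β' (x , ρα~x , h) =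
      x , subst (_~ x) (lastV-resp-≈ v α≃α') ρα~x , (≈-sym β≃β' ◅◅ h ◅◅ ++-congʳ [ x ] α≃α')

    ∼-target : ∀ {α β} ((x , _) : α ∼ β) → ρ G v β ≡ x
    ∼-target {α} (x , _ , h) = trans (lastV-resp-≈ v h) (lastV-++ v (proj₁ α) [ x ])

    ∼-sym : ∀ {α β} → α ∼ β → β ∼ α
    ∼-sym {a@(α , _)} {b@(β , _)} adj@(x , ρα~x , h) =
      lastV v α , subst (_~ lastV v α) (sym (∼-target {a} {b} adj)) (~-sym ρα~x) , backtrack
      where
      open ≈-Reasoning
      backtrack : v ∷ α ≈ v ∷ β ++ [ lastV v α ]
      backtrack = begin
        v ∷ α
          ≡⟨ cong (v ∷_) (++-identityʳ α) ⟨
        v ∷ α ++ []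
          ≈⟨ ∷-++-congʳ α refl (EqClosure.return (prune [] [] ρα~x)) ⟨
        v ∷ α ++ x ∷ lastV v α ∷ []
          ≡⟨ cong (v ∷_) (++-assoc α [ x ] [ lastV v α ]) ⟨
        v ∷ (α ++ [ x ]) ++ [ lastV v α ]
          ≈⟨ ++-congʳ [ lastV v α ] h ⟨
        v ∷ β ++ [ lastV v α ] ∎

    ∼-unique-lift : ∀ {α α' β β'} → α ≃ α' → α ∼ β → α' ∼ β' → ρ G v β ≡ ρ G v β' → β ≃ β'
    ∼-unique-lift {a@(α , _)} {a'@(α' , _)} {b@(β , _)} {b'@(β' , _)}
                  α≃α' adj@(x , _ , h) adj'@(x' , _ , h') ρβ≡ρβ' =
      begin
        v ∷ β             ≈⟨ h ⟩
        v ∷ α ++ [ x ]    ≈⟨ ++-congʳ [ x ] α≃α' ⟩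
        v ∷ α' ++ [ x ]   ≡⟨ cong (λ y → v ∷ α' ++ [ y ]) x≡x' ⟩
        v ∷ α' ++ [ x' ]  ≈⟨ h' ⟨
        v ∷ β'            ∎
      where
      open ≈-Reasoning
      x≡x' : x ≡ x'
      x≡x' = trans (sym (∼-target {a} {b} adj)) (trans ρβ≡ρβ' (∼-target {a'} {b'} adj'))

    -- Each vertex (xs , _) is joined to the root ([] , [-]) through the prefixes of xs.
    U-connected : (P : UVert G v → Set) →
                  (∀ {α β} → α ≃ β → P α → P β) → (∀ {α β} → α ∼ β → P α → P β) →
                  ∀ α β → P α → P β
    U-connected P P-resp-≃ P-resp-∼ (xs , lk) (ys , lk') =
      extend [] ys {[-]} lk' ∘ retract [] xs {[-]} lk
      where
      P-resp-≡ : ∀ {xs ys lk lk'} → xs ≡ ys → P (xs , lk) → P (ys , lk')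
      P-resp-≡ = P-resp-≃ ∘ ≡⇒≈ ∘ cong (v ∷_)

      reassoc : ∀ acc r rest → Linked _~_ (v ∷ acc ++ r ∷ rest) →
                Linked _~_ (v ∷ (acc ++ [ r ]) ++ rest)
      reassoc acc r rest = subst (λ xs → Linked _~_ (v ∷ xs)) (sym (++-assoc acc [ r ] rest))

      snoc-∼ : ∀ acc {r} (lk : Linked _~_ (v ∷ acc)) (e : lastV v acc ~ r) →
               (acc , lk) ∼ (acc ++ [ r ] , Linked-++ lk (e ∷ [-]))
      snoc-∼ acc lk e = _ , e , ε

      extend : ∀ acc rest {lk} (lk' : Linked _~_ (v ∷ acc ++ rest)) →
               P (acc , lk) → P (acc ++ rest , lk')
      extend acc []         lk' = P-resp-≡ (sym (++-identityʳ acc))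
      extend acc (r ∷ rest) {lk} lk' =
        P-resp-≡ (++-assoc acc [ r ] rest)
        ∘ extend (acc ++ [ r ]) rest {Linked-++ lk (e ∷ [-])}
                 (reassoc acc r rest lk')
        ∘ P-resp-∼ (snoc-∼ acc lk e)
        where e = Linked-junction acc lk'

      retract : ∀ acc rest {lk} (lk' : Linked _~_ (v ∷ acc ++ rest)) →
                P (acc ++ rest , lk') → P (acc , lk)
      retract acc []         lk' = P-resp-≡ (++-identityʳ acc)
      retract acc (r ∷ rest) {lk} lk' =
        P-resp-∼ (∼-sym {acc , lk} {acc ++ [ r ] , Linked-++ lk (e ∷ [-])} (snoc-∼ acc lk e))
        ∘ retract (acc ++ [ r ]) rest {Linked-++ lk (e ∷ [-])}
                  (reassoc acc r rest lk')
        ∘ P-resp-≡ (sym (++-assoc acc [ r ] rest))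
        where e = Linked-junction acc lk'

    deck-rigid : ∀ φ ψ α → f φ α ≃ f ψ α → _≈D_ G v φ ψ
    deck-rigid φ ψ α agree β = U-connected Agree resp-≃ resp-∼ α β agree
      where
      Agree : UVert G v → Set
      Agree γ = f φ γ ≃ f ψ γ

      resp-≃ : ∀ {γ γ'} → γ ≃ γ' → Agree γ → Agree γ'
      resp-≃ γ≃γ' a = ≈-sym (f-cong φ γ≃γ') ◅◅ a ◅◅ f-cong ψ γ≃γ'

      resp-∼ : ∀ {γ γ'} → γ ∼ γ' → Agree γ → Agree γ'
      resp-∼ {γ} {γ'} adj a =
        ∼-unique-lift {f φ γ} {f ψ γ} {f φ γ'} {f ψ γ'} a (f-adj φ adj) (f-adj ψ adj)
          (trans (f-ρ φ γ') (sym (f-ρ ψ γ')))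

    f-sends⇒g-sends : ∀ φ α β → f φ α ≃ β → g φ β ≃ α
    f-sends⇒g-sends φ α β fα≃β = ≈-sym (g-cong φ {f φ α} {β} fα≃β) ◅◅ gf φ α

    record ClosedWalk : Set where
      field
        walk   : List V
        linked : Linked _~_ (v ∷ walk)
        closed : lastV v walk ≡ v
    open ClosedWalk

    reverseClosedWalk : ClosedWalk → ClosedWalk
    reverseClosedWalk c = record
      { walk   = reverseTail v (walk c)
      ; linked = subst (λ z → Linked _~_ (z ∷ reverseTail v (walk c))) (closed c)
                   (Linked-reverseTail ~-sym (walk c) (linked c))
      ; closed = subst (λ z → lastV z (reverseTail v (walk c)) ≡ v) (closed c)
                   (lastV-reverseTail v (walk c)) }

    leftMul : ClosedWalk → UVert G v → UVert G v
    leftMul c (γ , lk) =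
      walk c ++ γ , Linked-++ (linked c) (subst (λ z → Linked _~_ (z ∷ γ)) (sym (closed c)) lk)

    leftMul-cong : ∀ c {α β} → α ≃ β → leftMul c α ≃ leftMul c β
    leftMul-cong c = ∷-++-congʳ (walk c) (closed c)

    leftMul-ρ : ∀ c α → ρ G v (leftMul c α) ≡ ρ G v α
    leftMul-ρ c (γ , _) = trans (lastV-++ v (walk c) γ) (cong (λ z → lastV z γ) (closed c))

    leftMul-adj : ∀ c {α β} → α ∼ β → leftMul c α ∼ leftMul c β
    leftMul-adj c {α} (x , ρα~x , h) =
      x , subst (_~ x) (sym (leftMul-ρ c α)) ρα~x ,
      (∷-++-congʳ (walk c) (closed c) h
        ◅◅ ≡⇒≈ (cong (v ∷_) (sym (++-assoc (walk c) (proj₁ α) [ x ]))))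

    leftMul-reverse : ∀ c α → leftMul c (leftMul (reverseClosedWalk c) α) ≃ α
    leftMul-reverse c (γ , _) = cancel-reverseTail (walk c) γ (linked c)

    reverse-leftMul : ∀ c α → leftMul (reverseClosedWalk c) (leftMul c α) ≃ α
    reverse-leftMul c (γ , _) =
      subst (λ z → z ∷ reverseTail v (walk c) ++ walk c ++ γ ≈ z ∷ γ) (closed c)
        (cancel-reverseTail′ (walk c) γ (linked c))

    reflects-∼ : (h k : UVert G v → UVert G v) → (∀ γ → k (h γ) ≃ γ) →
                 (∀ {α β} → α ∼ β → k α ∼ k β) → ∀ {α β} → h α ∼ h β → α ∼ β
    reflects-∼ h k kh≃id k-adj {α} {β} adj =
      ∼-resp-≃ {k (h α)} {α} {k (h β)} {β} (kh≃id α) (kh≃id β) (k-adj adj)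

    leftMulDeck : ClosedWalk → Deck G v
    leftMulDeck c = record
      { f = leftMul c ; g = leftMul c⁻¹
      ; f-cong = λ {α β} → leftMul-cong c {α} {β}
      ; g-cong = λ {α β} → leftMul-cong c⁻¹ {α} {β}
      ; fg = leftMul-reverse c ; gf = reverse-leftMul c
      ; f-adj = λ {α β} → leftMul-adj c {α} {β}
      ; g-adj = λ {α β} → leftMul-adj c⁻¹ {α} {β}
      ; f-adj⁻ = λ {α β} → reflects-∼ (leftMul c) (leftMul c⁻¹) (reverse-leftMul c)
                              (λ {γ δ} → leftMul-adj c⁻¹ {γ} {δ}) {α} {β}
      ; g-adj⁻ = λ {α β} → reflects-∼ (leftMul c⁻¹) (leftMul c) (leftMul-reverse c)
                              (λ {γ δ} → leftMul-adj c {γ} {δ}) {α} {β}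
      ; f-ρ = leftMul-ρ c ; g-ρ = leftMul-ρ c⁻¹ }
      where
      c⁻¹ = reverseClosedWalk c

    deck-transitive : ∀ α β → ρ G v α ≡ ρ G v β → Σ (Deck G v) (λ φ → f φ α ≃ β)
    deck-transitive (α , lkα) (β , lkβ) ρα≡ρβ = leftMulDeck βα⁻¹ , sends
      where
      βα⁻¹ : ClosedWalk
      βα⁻¹ = record
        { walk   = β ++ reverseTail v α
        ; linked = Linked-++ lkβ (subst (λ z → Linked _~_ (z ∷ reverseTail v α)) ρα≡ρβ
                                   (Linked-reverseTail ~-sym α lkα))
        ; closed = trans (lastV-++ v β (reverseTail v α))
                     (trans (cong (λ z → lastV z (reverseTail v α)) (sym ρα≡ρβ))
                       (lastV-reverseTail v α)) }

      open ≈-Reasoning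
      sends : v ∷ (β ++ reverseTail v α) ++ α ≈ v ∷ β
      sends = begin
        v ∷ (β ++ reverseTail v α) ++ α   ≡⟨ cong (v ∷_) (++-assoc β (reverseTail v α) α) ⟩
        v ∷ β ++ reverseTail v α ++ α
          ≡⟨ cong (λ t → v ∷ β ++ reverseTail v α ++ t) (++-identityʳ α) ⟨
        v ∷ β ++ reverseTail v α ++ α ++ []
          ≈⟨ ∷-++-congʳ β (sym ρα≡ρβ) (cancel-reverseTail′ α [] lkα) ⟩
        v ∷ β ++ []                       ≡⟨ cong (v ∷_) (++-identityʳ β) ⟩
        v ∷ β                             ∎

    module _ (S : Subgroup G v) {w : V} (α₀ : UVert G v) (ρα₀≡w : ρ G v α₀ ≡ w) where

      toCoset : Fibre G v S w → Deck G v
      toCoset (α , ρα≡w) = proj₁ (deck-transitive α α₀ (trans ρα≡w (sym ρα₀≡w)))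

      toCoset-sends : ∀ a → f (toCoset a) (proj₁ a) ≃ α₀
      toCoset-sends (α , ρα≡w) = proj₂ (deck-transitive α α₀ (trans ρα≡w (sym ρα₀≡w)))

      fromCoset : Deck G v → Fibre G v S w
      fromCoset φ = g φ α₀ , trans (g-ρ φ α₀) ρα₀≡w

      fibre≅cosets : QuotBij (_∼orbit_ G v S {w}) (_∼coset_ G v S)
      fibre≅cosets = record
        { to = toCoset ; from = fromCoset
        ; to-resp = λ {a b} → to-resp {a} {b} ; from-resp = λ {φ ψ} → from-resp {φ} {ψ}
        ; from-to = from-to ; to-from = to-from }
        where
        open ≃-Reasoning

        from-to : ∀ a → _∼orbit_ G v S (fromCoset (toCoset a)) a
        from-to a = idD G v , P-id S , f-sends⇒g-sends (toCoset a) (proj₁ a) α₀ (toCoset-sends a)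

        from-resp : ∀ {φ ψ} → _∼coset_ G v S φ ψ → _∼orbit_ G v S (fromCoset φ) (fromCoset ψ)
        from-resp {φ} {ψ} φ⁻¹ψ∈S =
          (φ ⁻¹ · ψ) ⁻¹ , P-inv S φ⁻¹ψ∈S , g-cong ψ {f φ (g φ α₀)} {α₀} (fg φ α₀)

        to-resp : ∀ {a b} → _∼orbit_ G v S a b → _∼coset_ G v S (toCoset a) (toCoset b)
        to-resp {a@(α , _)} {b@(β , _)} (s , s∈S , sα≃β) =
          P-resp S (deck-rigid (s ⁻¹) (toCoset a ⁻¹ · toCoset b) β agree) (P-inv S s∈S)
          where
          agree : g s β ≃ g (toCoset a) (f (toCoset b) β)
          agree = begin
            g s β
              ≈⟨ f-sends⇒g-sends s α β sα≃β ⟩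
            α
              ≈⟨ f-sends⇒g-sends (toCoset a) α α₀ (toCoset-sends a) ⟨
            g (toCoset a) α₀
              ≈⟨ g-cong (toCoset a) {f (toCoset b) β} {α₀} (toCoset-sends b) ⟨
            g (toCoset a) (f (toCoset b) β) ∎

        to-from : ∀ ψ → _∼coset_ G v S (toCoset (fromCoset ψ)) ψ
        to-from ψ = P-resp S (deck-rigid (idD G v) (toCoset δ ⁻¹ · ψ) (proj₁ δ) agree) (P-id S)
          where
          δ = fromCoset ψ
          agree : g ψ α₀ ≃ g (toCoset δ) (f ψ (g ψ α₀))
          agree = begin
            g ψ α₀
              ≈⟨ f-sends⇒g-sends (toCoset δ) (g ψ α₀) α₀ (toCoset-sends δ) ⟨
            g (toCoset δ) α₀
              ≈⟨ g-cong (toCoset δ) {f ψ (g ψ α₀)} {α₀} (fg ψ α₀) ⟨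
            g (toCoset δ) (f ψ (g ψ α₀)) ∎

corollary3p32 : (G : Graph) (v : Graph.V G) (S : Subgroup G v) (w : Graph.V G) →
    QuotBij (_∼orbit_ G v S {w}) (_∼coset_ G v S)
corollary3p32 G v S w with Graph.connected G v w
... | xs , lk , ρ≡w = fibre≅cosets G v S (xs , lk) ρ≡w
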